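{- Let $(V,*)$ be a travel groupoid and for $u,v\in V$ let $V_{u,v}=\{w\in V\mid u*w=v\}$. Then the following are equivalent: (a) $(V,*)$ is simple, i.e. for all $u,v\in V$, if $v*u\neq u$ then $u*(v*u)=u*v$; (b) for all $u,v,x,y\in V$, if $u\in V_{v,x}$, $v\in V_{u,y}$, $u\neq x$ and $v\neq y$, then $x\in V_{u,y}$ and $y\in V_{v,x}$.
   Context: A travel groupoid is a nonempty set $V$ with a binary operation $*$ satisfying (t1) $(u*v)*u=u$ for all $u,v\in V$, and (t2) for all $u,v\in V$, if $(u*v)*v=u$ then $u=v$. -}

module Defs where

open import Level using (Level; suc; _⊔_)
open import Relation.Binary.PropositionalEquality using (_≡_)
open import Relation.Nullary using (¬_)
open import Data.Product using (_×_)

record TravelGroupoid (ℓ : Level) : Set (suc ℓ) where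
  infixl 7 _*_
  field
    V     : Set ℓ
    _*_   : V → V → V
    point : V                                   -- nonemptiness
    t1    : ∀ u v → (u * v) * u ≡ u
    t2    : ∀ u v → (u * v) * v ≡ u → u ≡ v

module _ {ℓ : Level} (G : TravelGroupoid ℓ) where
  open TravelGroupoid G

  V[_,_] : V → V → V → Set ℓ
  V[ u , v ] w = u * w ≡ v

  IsSimple : Set ℓ
  IsSimple = ∀ u v → ¬ (v * u ≡ u) → u * (v * u) ≡ u * v

  ConditionB : Set ℓ
  ConditionB = ∀ u v x y → V[ v , x ] u → V[ u , y ] v → ¬ (u ≡ x) → ¬ (v ≡ y)
             → V[ u , y ] x × V[ v , x ] y

module Submission where

-- Condition (b) is simplicity read off along both orders of a pair: if
-- x = v * u and y = u * v, its two conclusions u * (v * u) = u * v and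
-- v * (u * v) = v * u are the simplicity equations at (u , v) and at (v , u).
-- Hence
--   (a ⇒ b)  apply simplicity twice, once in each order of the pair;
--   (b ⇒ a)  instantiate (b) at x = v * u, y = u * v and keep the first
--            conclusion.  The only side condition not given directly is
--            v ≢ u * v, which follows from v * u ≢ u by axiom (t1):
--            if v = u * v then v * u = (u * v) * u = u.

open import Defs
open import Level using (Level)
open import Function.Bundles using (_⇔_; mk⇔)
open import Data.Product using (_,_; proj₁)
open import Relation.Nullary using (¬_)
open import Relation.Binary.PropositionalEquality using (_≡_; refl; sym; trans; cong)

module _ {ℓ : Level} (G : TravelGroupoid ℓ) where
  open TravelGroupoid G

  fixed-by-left⇒returns : ∀ u v → v ≡ u * v → v * u ≡ u
  fixed-by-left⇒returns u v v≡u*v = trans (cong (_* u) v≡u*v) (t1 u v)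

  not-returning⇒not-fixed : ∀ u v → ¬ (v * u ≡ u) → ¬ (v ≡ u * v)
  not-returning⇒not-fixed u v v*u≢u v≡u*v = v*u≢u (fixed-by-left⇒returns u v v≡u*v)

  simple⇒conditionB : IsSimple G → ConditionB G
  simple⇒conditionB simple u v ._ ._ refl refl u≢v*u v≢u*v =
      simple u v (λ v*u≡u → u≢v*u (sym v*u≡u))
    , simple v u (λ u*v≡v → v≢u*v (sym u*v≡v))

  conditionB⇒simple : ConditionB G → IsSimple G
  conditionB⇒simple condB u v v*u≢u =
    proj₁ (condB u v (v * u) (u * v) refl refl
                 (λ u≡v*u → v*u≢u (sym u≡v*u))
                 (not-returning⇒not-fixed u v v*u≢u))

proposition4p1 : ∀ {ℓ : Level} (G : TravelGroupoid ℓ) → IsSimple G ⇔ ConditionB G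
proposition4p1 G = mk⇔ (simple⇒conditionB G) (conditionB⇒simple G)
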